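{- Let $p>3$ be a prime and $R=a^2f^2-abef-2acdf+ace^2+b^2df-bcde+c^2d^2\in\mathbb{Z}[a,b,c,d,e,f]$. Then the set $\bar B_p'$ of $(a,b,c,d,e,f)\in(\mathbb{Z}/p\mathbb{Z})^6$ with $R=0$ and $\frac{\partial R}{\partial a}=\frac{\partial R}{\partial b}=\dots=\frac{\partial R}{\partial f}=0$ at that point satisfies $\#\bar B_p'<p^4+3p^3$.
   Context: $R$ is the resultant of $aX^2+bXY+cY^2$ and $dX^2+eXY+fY^2$. -}

module Defs where

open import Data.Nat as ℕ using (ℕ)
open import Data.Nat.Divisibility using (_∣?_)
open import Data.Integer using (ℤ; +_; _+_; _-_; _*_; ∣_∣)
open import Data.Integer.Divisibility using (_∣_)
open import Data.Fin using (Fin; toℕ)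
open import Data.Vec using (Vec; []; _∷_)
open import Data.List using (List; []; _∷_; length; filter; map; allFin; concatMap)
open import Data.Product using (_×_)
open import Relation.Nullary.Decidable using (Dec; _×-dec_)

-- The polynomial R (resultant of aX²+bXY+cY² and dX²+eXY+fY²) over ℤ
R : ℤ → ℤ → ℤ → ℤ → ℤ → ℤ → ℤ
R a b c d e f =
  a * a * f * f - a * b * e * f - + 2 * a * c * d * f + a * c * e * e
  + b * b * d * f - b * c * d * e + c * c * d * d

Ra Rb Rc Rd Re Rf : ℤ → ℤ → ℤ → ℤ → ℤ → ℤ → ℤ
Ra a b c d e f = + 2 * a * f * f - b * e * f - + 2 * c * d * f + c * e * e
Rb a b c d e f = (+ 0) - a * e * f + + 2 * b * d * f - c * d * e
Rc a b c d e f = (+ 0) - + 2 * a * d * f + a * e * e - b * d * e + + 2 * c * d * d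
Rd a b c d e f = (+ 0) - + 2 * a * c * f + b * b * f - b * c * e + + 2 * c * c * d
Re a b c d e f = (+ 0) - a * b * f + + 2 * a * c * e - b * c * d
Rf a b c d e f = + 2 * a * a * f - a * b * e - + 2 * a * c * d + b * b * d

-- Elements of ℤ/pℤ are represented by Fin p (residues 0,…,p-1);
-- a polynomial vanishes at a point of (ℤ/pℤ)^6 iff p divides its value
-- at the integer lifts of the coordinates.
lift : {p : ℕ} → Fin p → ℤ
lift x = + toℕ x

VanishesMod : (p : ℕ) → (ℤ → ℤ → ℤ → ℤ → ℤ → ℤ → ℤ) → Vec (Fin p) 6 → Set
VanishesMod p P (a ∷ b ∷ c ∷ d ∷ e ∷ f ∷ []) =
  + p ∣ P (lift a) (lift b) (lift c) (lift d) (lift e) (lift f)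

vanishesMod? : (p : ℕ) → (P : ℤ → ℤ → ℤ → ℤ → ℤ → ℤ → ℤ) → (v : Vec (Fin p) 6) → Dec (VanishesMod p P v)
vanishesMod? p P (a ∷ b ∷ c ∷ d ∷ e ∷ f ∷ []) =
  p ∣? ∣ P (lift a) (lift b) (lift c) (lift d) (lift e) (lift f) ∣

InB' : (p : ℕ) → Vec (Fin p) 6 → Set
InB' p v = VanishesMod p R v × VanishesMod p Ra v × VanishesMod p Rb v
         × VanishesMod p Rc v × VanishesMod p Rd v × VanishesMod p Re v
         × VanishesMod p Rf v

inB'? : (p : ℕ) → (v : Vec (Fin p) 6) → Dec (InB' p v)
inB'? p v = vanishesMod? p R v ×-dec vanishesMod? p Ra v ×-dec vanishesMod? p Rb v
          ×-dec vanishesMod? p Rc v ×-dec vanishesMod? p Rd v ×-dec vanishesMod? p Re v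
          ×-dec vanishesMod? p Rf v

allVecs : (p k : ℕ) → List (Vec (Fin p) k)
allVecs p ℕ.zero = [] ∷ []
allVecs p (ℕ.suc k) = concatMap (λ x → map (x ∷_) (allVecs p k)) (allFin p)

cardB' : ℕ → ℕ
cardB' p = length (filter (inB'? p) (allVecs p 6))

-- At a singular point of R the rows u = (a, b, c) and w = (d, e, f) are
-- parallel modulo p: the squares of the 2×2 minors satisfy
--   (ae − bd)² = a R_c + d R_f,   (bf − ce)² = c R_a + f R_d,
--   (af − cd)² = R + (ae − bd)(bf − ce),
-- so p divides each minor. A parallel pair with u ≢ 0 is recovered from u and
-- the entry of w at a coordinate where u is nonzero, and a pair with u ≡ 0 from
-- w alone; this injects B̄'_p into (ℤ/p)⁴ ⊎ (ℤ/p)³, so #B̄'_p ≤ p⁴ + p³.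
module Submission where

open import Defs
open import Data.Nat using (ℕ; _<_; _+_; _*_; _^_)
open import Data.Nat.Primality using (Prime; euclidsLemma)

open import Data.Fin using (Fin; toℕ; zero; suc)
open import Data.Fin.Patterns using (0F; 1F; 2F)
open import Data.Fin.Properties using (toℕ<n; toℕ-injective; any?; injective⇒≤)
open import Data.Integer as ℤ using (ℤ; +_; -_; ∣_∣)
  renaming (_+_ to _+ᶻ_; _*_ to _*ᶻ_; _-_ to _-ᶻ_)
import Data.Integer.Properties as ℤ
open import Data.Integer.Divisibility.Signed
  using (_∣_; _∣?_; divides; ∣ᵤ⇒∣; ∣⇒∣ᵤ; ∣m∣n⇒∣m+n; ∣m∣n⇒∣m-n; ∣m⇒∣-m; ∣n⇒∣m*n)
open import Data.Integer.Tactic.RingSolver using (solve-∀)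
open import Data.List
  using (List; []; _∷_; _++_; length; lookup; map; concatMap; cartesianProductWith; filter; allFin)
import Data.List.Properties as List
open import Data.List.Membership.Propositional using (_∈_)
open import Data.List.Membership.Propositional.Properties
  using (∈-lookup; ∈-map⁺; ∈-++⁺ˡ; ∈-++⁺ʳ; ∈-filter⁻; ∈-allFin; ∈-cartesianProductWith⁺)
import Data.List.Relation.Unary.All as All
import Data.List.Relation.Unary.AllPairs as AllPairs
open import Data.List.Relation.Unary.Any using (here; index)
open import Data.List.Relation.Unary.Any.Properties using (lookup-index)
open import Data.List.Relation.Unary.Unique.Propositional using (Unique)
import Data.List.Relation.Unary.Unique.Propositional.Properties as Unique
import Data.Nat as ℕ
import Data.Nat.Divisibility as ℕ
import Data.Nat.Properties as ℕ
open import Data.Product using (_×_; _,_; proj₂; ∃)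
open import Data.Sum as Sum using (_⊎_; inj₁; inj₂; reduce)
open import Data.Sum.Properties using (inj₁-injective; inj₂-injective)
open import Data.Vec as Vec using (Vec; []; _∷_; take; drop)
import Data.Vec.Properties as Vec
open import Data.Vec.Relation.Binary.Pointwise.Extensional using (ext; Pointwise-≡⇒≡)
open import Function using (_∘_)
open import Relation.Binary.PropositionalEquality
  using (_≡_; refl; sym; trans; cong; cong₂; subst; module ≡-Reasoning)
open import Relation.Nullary using (¬_; Dec; yes; no; ¬?; contradiction)
open import Relation.Nullary.Decidable using (decidable-stable)

module _ {A B C : Set} (f : A → B → C) where

  concatMap≡cartesianProductWith : ∀ xs ys →
    concatMap (λ x → map (f x) ys) xs ≡ cartesianProductWith f xs ys
  concatMap≡cartesianProductWith []       ys = refl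
  concatMap≡cartesianProductWith (x ∷ xs) ys =
    cong (map (f x) ys ++_) (concatMap≡cartesianProductWith xs ys)

  length-cartesianProductWith : ∀ xs ys →
    length (cartesianProductWith f xs ys) ≡ length xs * length ys
  length-cartesianProductWith []       ys = refl
  length-cartesianProductWith (x ∷ xs) ys = begin
    length (map (f x) ys ++ cartesianProductWith f xs ys)
      ≡⟨ List.length-++ (map (f x) ys) ⟩
    length (map (f x) ys) + length (cartesianProductWith f xs ys)
      ≡⟨ cong₂ _+_ (List.length-map (f x) ys) (length-cartesianProductWith xs ys) ⟩
    length ys + length xs * length ys ∎
    where open ≡-Reasoning

module _ (p : ℕ) where

  allVecs-suc : ∀ k → allVecs p (ℕ.suc k) ≡ cartesianProductWith _∷_ (allFin p) (allVecs p k)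
  allVecs-suc k = concatMap≡cartesianProductWith _∷_ (allFin p) (allVecs p k)

  allVecs-unique : ∀ k → Unique (allVecs p k)
  allVecs-unique ℕ.zero    = All.[] AllPairs.∷ AllPairs.[]
  allVecs-unique (ℕ.suc k) rewrite allVecs-suc k =
    Unique.cartesianProductWith⁺ _∷_ Vec.∷-injective (Unique.allFin⁺ p) (allVecs-unique k)

  ∈-allVecs : ∀ {k} (v : Vec (Fin p) k) → v ∈ allVecs p k
  ∈-allVecs []      = here refl
  ∈-allVecs {ℕ.suc k} (x ∷ v) rewrite allVecs-suc k =
    ∈-cartesianProductWith⁺ _∷_ (∈-allFin x) (∈-allVecs v)

  length-allVecs : ∀ k → length (allVecs p k) ≡ p ^ k
  length-allVecs ℕ.zero    = refl
  length-allVecs (ℕ.suc k) rewrite allVecs-suc k =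
    trans (length-cartesianProductWith _∷_ (allFin p) (allVecs p k))
          (cong₂ _*_ (List.length-tabulate {n = p} (λ i → i)) (length-allVecs k))

  allVecs⊎ : ∀ m n → List (Vec (Fin p) m ⊎ Vec (Fin p) n)
  allVecs⊎ m n = map inj₁ (allVecs p m) ++ map inj₂ (allVecs p n)

  ∈-allVecs⊎ : ∀ {m n} (x : Vec (Fin p) m ⊎ Vec (Fin p) n) → x ∈ allVecs⊎ m n
  ∈-allVecs⊎         (inj₁ u) = ∈-++⁺ˡ (∈-map⁺ inj₁ (∈-allVecs u))
  ∈-allVecs⊎ {m} {n} (inj₂ w) = ∈-++⁺ʳ (map inj₁ (allVecs p m)) (∈-map⁺ inj₂ (∈-allVecs w))

  length-allVecs⊎ : ∀ m n → length (allVecs⊎ m n) ≡ p ^ m + p ^ n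
  length-allVecs⊎ m n = begin
    length (map inj₁ (allVecs p m) ++ map inj₂ (allVecs p n))
      ≡⟨ List.length-++ (map inj₁ (allVecs p m)) ⟩
    length (map inj₁ (allVecs p m)) + length (map inj₂ (allVecs p n))
      ≡⟨ cong₂ _+_ (List.length-map inj₁ (allVecs p m)) (List.length-map inj₂ (allVecs p n)) ⟩
    length (allVecs p m) + length (allVecs p n)
      ≡⟨ cong₂ _+_ (length-allVecs m) (length-allVecs n) ⟩
    p ^ m + p ^ n ∎
    where open ≡-Reasoning

module _ {A : Set} where

  unique⇒lookup-injective : ∀ {xs : List A} → Unique xs →
                            ∀ i j → lookup xs i ≡ lookup xs j → i ≡ j
  unique⇒lookup-injective (_ AllPairs.∷ _)     zero    zero    _  = refl
  unique⇒lookup-injective (x∉xs AllPairs.∷ _)  zero    (suc j) eq =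
    contradiction eq (All.lookup x∉xs (∈-lookup j))
  unique⇒lookup-injective (x∉xs AllPairs.∷ _)  (suc i) zero    eq =
    contradiction (sym eq) (All.lookup x∉xs (∈-lookup i))
  unique⇒lookup-injective (_ AllPairs.∷ xs!)   (suc i) (suc j) eq =
    cong suc (unique⇒lookup-injective xs! i j eq)

module _ {A B : Set} (h : A → B) {xs : List A} {ys : List B} where

  unique-injection⇒length≤ : Unique xs →
                          (∀ {x y} → x ∈ xs → y ∈ xs → h x ≡ h y → x ≡ y) →
                          (∀ {x} → x ∈ xs → h x ∈ ys) →
                          length xs ℕ.≤ length ys
  unique-injection⇒length≤ xs! h-injective h∈ys = injective⇒≤ position-injective
    where
    position : Fin (length xs) → Fin (length ys)
    position i = index (h∈ys (∈-lookup i))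

    position-injective : ∀ {i j} → position i ≡ position j → i ≡ j
    position-injective {i} {j} eq =
      unique⇒lookup-injective xs! i j (h-injective (∈-lookup i) (∈-lookup j) (begin
        h (lookup xs i)        ≡⟨ lookup-index (h∈ys (∈-lookup i)) ⟩
        lookup ys (position i) ≡⟨ cong (lookup ys) eq ⟩
        lookup ys (position j) ≡⟨ lookup-index (h∈ys (∈-lookup j)) ⟨
        h (lookup xs j)        ∎))
      where open ≡-Reasoning

-- The ring solver does not unfold R and its partial derivatives, so each identity
-- is proved in a copy with the definitions expanded.
square-ae-bd : ∀ a b c d e f →
  (a *ᶻ e -ᶻ b *ᶻ d) *ᶻ (a *ᶻ e -ᶻ b *ᶻ d) ≡ a *ᶻ Rc a b c d e f +ᶻ d *ᶻ Rf a b c d e f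
square-ae-bd = expanded
  where
  expanded : ∀ a b c d e f → (a *ᶻ e -ᶻ b *ᶻ d) *ᶻ (a *ᶻ e -ᶻ b *ᶻ d) ≡
    a *ᶻ ((+ 0) -ᶻ + 2 *ᶻ a *ᶻ d *ᶻ f +ᶻ a *ᶻ e *ᶻ e -ᶻ b *ᶻ d *ᶻ e +ᶻ + 2 *ᶻ c *ᶻ d *ᶻ d)
    +ᶻ d *ᶻ (+ 2 *ᶻ a *ᶻ a *ᶻ f -ᶻ a *ᶻ b *ᶻ e -ᶻ + 2 *ᶻ a *ᶻ c *ᶻ d +ᶻ b *ᶻ b *ᶻ d)
  expanded = solve-∀

square-bf-ce : ∀ a b c d e f →
  (b *ᶻ f -ᶻ c *ᶻ e) *ᶻ (b *ᶻ f -ᶻ c *ᶻ e) ≡ c *ᶻ Ra a b c d e f +ᶻ f *ᶻ Rd a b c d e f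
square-bf-ce = expanded
  where
  expanded : ∀ a b c d e f → (b *ᶻ f -ᶻ c *ᶻ e) *ᶻ (b *ᶻ f -ᶻ c *ᶻ e) ≡
    c *ᶻ (+ 2 *ᶻ a *ᶻ f *ᶻ f -ᶻ b *ᶻ e *ᶻ f -ᶻ + 2 *ᶻ c *ᶻ d *ᶻ f +ᶻ c *ᶻ e *ᶻ e)
    +ᶻ f *ᶻ ((+ 0) -ᶻ + 2 *ᶻ a *ᶻ c *ᶻ f +ᶻ b *ᶻ b *ᶻ f -ᶻ b *ᶻ c *ᶻ e +ᶻ + 2 *ᶻ c *ᶻ c *ᶻ d)
  expanded = solve-∀

square-af-cd : ∀ a b c d e f →
  (a *ᶻ f -ᶻ c *ᶻ d) *ᶻ (a *ᶻ f -ᶻ c *ᶻ d) ≡ R a b c d e f +ᶻ (a *ᶻ e -ᶻ b *ᶻ d) *ᶻ (b *ᶻ f -ᶻ c *ᶻ e)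
square-af-cd = expanded
  where
  expanded : ∀ a b c d e f → (a *ᶻ f -ᶻ c *ᶻ d) *ᶻ (a *ᶻ f -ᶻ c *ᶻ d) ≡
    (a *ᶻ a *ᶻ f *ᶻ f -ᶻ a *ᶻ b *ᶻ e *ᶻ f -ᶻ + 2 *ᶻ a *ᶻ c *ᶻ d *ᶻ f +ᶻ a *ᶻ c *ᶻ e *ᶻ e
     +ᶻ b *ᶻ b *ᶻ d *ᶻ f -ᶻ b *ᶻ c *ᶻ d *ᶻ e +ᶻ c *ᶻ c *ᶻ d *ᶻ d)
    +ᶻ (a *ᶻ e -ᶻ b *ᶻ d) *ᶻ (b *ᶻ f -ᶻ c *ᶻ e)
  expanded = solve-∀

module _ {p : ℕ} where

  lift-injective-mod : {x y : Fin p} → + p ∣ lift x -ᶻ lift y → x ≡ y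
  lift-injective-mod {x} {y} p∣x-y =
    toℕ-injective (ℤ.+-injective (ℤ.i-j≡0⇒i≡j (lift x) (lift y) (ℤ.∣i∣≡0⇒i≡0 ∣x-y∣≡0)))
    where
    ∣x-y∣<p : ∣ lift x -ᶻ lift y ∣ < p
    ∣x-y∣<p = begin-strict
      ∣ lift x -ᶻ lift y ∣    ≡⟨ cong ∣_∣ (ℤ.m-n≡m⊖n (toℕ x) (toℕ y)) ⟩
      ∣ toℕ x ℤ.⊖ toℕ y ∣     ≤⟨ ℤ.∣m⊝n∣≤m⊔n (toℕ x) (toℕ y) ⟩
      toℕ x ℕ.⊔ toℕ y         <⟨ ℕ.⊔-lub (toℕ<n x) (toℕ<n y) ⟩
      p                       ∎
      where open ℕ.≤-Reasoning

    ∣x-y∣≡0 : ∣ lift x -ᶻ lift y ∣ ≡ 0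
    ∣x-y∣≡0 with ∣ lift x -ᶻ lift y ∣ ℕ.≟ 0
    ... | yes ≡0 = ≡0
    ... | no  ≢0 = contradiction (∣⇒∣ᵤ p∣x-y) (ℕ.>⇒∤ {{ℕ.≢-nonZero ≢0}} ∣x-y∣<p)

  module _ {n : ℕ} where

    minor : Vec (Fin p) n → Vec (Fin p) n → Fin n → Fin n → ℤ
    minor u w i j =
      lift (Vec.lookup u i) *ᶻ lift (Vec.lookup w j) -ᶻ lift (Vec.lookup u j) *ᶻ lift (Vec.lookup w i)

    Parallel : Vec (Fin p) n → Vec (Fin p) n → Set
    Parallel u w = ∀ i j → + p ∣ minor u w i j

    ∣-minor-diag : ∀ u w i → + p ∣ minor u w i i
    ∣-minor-diag u w i = subst (+ p ∣_) (sym (ℤ.+-inverseʳ uᵢwᵢ)) (divides (+ 0) refl)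
      where uᵢwᵢ = lift (Vec.lookup u i) *ᶻ lift (Vec.lookup w i)

    ∣-minor-swap : ∀ u w i j → + p ∣ minor u w i j → + p ∣ minor u w j i
    ∣-minor-swap u w i j p∣m = subst (+ p ∣_) (neg-minus uᵢwⱼ uⱼwᵢ) (∣m⇒∣-m p∣m)
      where
      uᵢwⱼ = lift (Vec.lookup u i) *ᶻ lift (Vec.lookup w j)
      uⱼwᵢ = lift (Vec.lookup u j) *ᶻ lift (Vec.lookup w i)
      neg-minus : ∀ x y → - (x -ᶻ y) ≡ y -ᶻ x
      neg-minus = solve-∀

    NonzeroEntry : Vec (Fin p) n → Set
    NonzeroEntry u = ∃ λ i → ¬ + p ∣ lift (Vec.lookup u i)

    nonzeroEntry? : (u : Vec (Fin p) n) → Dec (NonzeroEntry u)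
    nonzeroEntry? u = any? (λ i → ¬? (+ p ∣? lift (Vec.lookup u i)))

    encode : Vec (Fin p) n → Vec (Fin p) n → Vec (Fin p) (ℕ.suc n) ⊎ Vec (Fin p) n
    encode u w with nonzeroEntry? u
    ... | yes (i , _) = inj₁ (Vec.lookup w i ∷ u)
    ... | no  _       = inj₂ w

    encode-injectiveˡ : ∀ {u w u′ w′} → encode u w ≡ encode u′ w′ → u ≡ u′
    encode-injectiveˡ {u} {_} {u′} eq with nonzeroEntry? u | nonzeroEntry? u′
    ... | yes _  | yes _   = Vec.∷-injectiveʳ (inj₁-injective eq)
    ... | no u≈0 | no u′≈0 = Pointwise-≡⇒≡ (ext λ i →
      lift-injective-mod (∣m∣n⇒∣m-n (zero-entry {u} u≈0 i) (zero-entry {u′} u′≈0 i)))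
      where
      zero-entry : ∀ {v} → ¬ NonzeroEntry v → ∀ i → + p ∣ lift (Vec.lookup v i)
      zero-entry {v} v≈0 i = decidable-stable (+ p ∣? _) (λ p∤vᵢ → v≈0 (i , p∤vᵢ))
    encode-injectiveˡ () | yes _ | no _
    encode-injectiveˡ () | no _  | yes _

  parallel₃ : ∀ {u w : Vec (Fin p) 3} →
              + p ∣ minor u w 0F 1F → + p ∣ minor u w 0F 2F → + p ∣ minor u w 1F 2F →
              Parallel u w
  parallel₃ {u} {w} p∣m₀₁ p∣m₀₂ p∣m₁₂ = λ where
    0F 0F → ∣-minor-diag u w 0F
    0F 1F → p∣m₀₁
    0F 2F → p∣m₀₂
    1F 0F → ∣-minor-swap u w 0F 1F p∣m₀₁
    1F 1F → ∣-minor-diag u w 1F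
    1F 2F → p∣m₁₂
    2F 0F → ∣-minor-swap u w 0F 2F p∣m₀₂
    2F 1F → ∣-minor-swap u w 1F 2F p∣m₁₂
    2F 2F → ∣-minor-diag u w 2F

  module _ (p-prime : Prime p) where

    euclidsLemmaᶻ : ∀ x y → + p ∣ x *ᶻ y → (+ p ∣ x) ⊎ (+ p ∣ y)
    euclidsLemmaᶻ x y p∣xy = Sum.map ∣ᵤ⇒∣ ∣ᵤ⇒∣
      (euclidsLemma ∣ x ∣ ∣ y ∣ p-prime (subst (p ℕ.∣_) (ℤ.abs-* x y) (∣⇒∣ᵤ p∣xy)))

    ∣m*m⇒∣m : ∀ x → + p ∣ x *ᶻ x → + p ∣ x
    ∣m*m⇒∣m x p∣x² = reduce (euclidsLemmaᶻ x x p∣x²)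

    ∣m*n∧∤m⇒∣n : ∀ {m n} → + p ∣ m *ᶻ n → ¬ + p ∣ m → + p ∣ n
    ∣m*n∧∤m⇒∣n {m} {n} p∣mn p∤m with euclidsLemmaᶻ m n p∣mn
    ... | inj₁ p∣m = contradiction p∣m p∤m
    ... | inj₂ p∣n = p∣n

    module _ {n : ℕ} where

      parallel-determined : ∀ {u w w′ : Vec (Fin p) n} i → ¬ + p ∣ lift (Vec.lookup u i) →
                            Parallel u w → Parallel u w′ →
                            Vec.lookup w i ≡ Vec.lookup w′ i → w ≡ w′
      parallel-determined {u} {w} {w′} i p∤uᵢ u∥w u∥w′ wᵢ≡w′ᵢ = Pointwise-≡⇒≡ (ext λ j →
        lift-injective-mod (∣m*n∧∤m⇒∣n
          (subst (+ p ∣_) (diff j) (∣m∣n⇒∣m-n (u∥w i j) (u∥w′ i j))) p∤uᵢ))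
        where
        sub-common : ∀ a x y k → (a *ᶻ x -ᶻ k) -ᶻ (a *ᶻ y -ᶻ k) ≡ a *ᶻ (x -ᶻ y)
        sub-common = solve-∀
        diff : ∀ j → minor u w i j -ᶻ minor u w′ i j
                   ≡ lift (Vec.lookup u i) *ᶻ (lift (Vec.lookup w j) -ᶻ lift (Vec.lookup w′ j))
        diff j rewrite sym wᵢ≡w′ᵢ =
          sub-common (lift (Vec.lookup u i)) (lift (Vec.lookup w j)) (lift (Vec.lookup w′ j))
                     (lift (Vec.lookup u j) *ᶻ lift (Vec.lookup w i))

      encode-injective : ∀ {u w u′ w′ : Vec (Fin p) n} → Parallel u w → Parallel u′ w′ →
                         encode u w ≡ encode u′ w′ → u ≡ u′ × w ≡ w′
      encode-injective {u} {w} {u′} {w′} u∥w u′∥w′ eq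
        with refl ← encode-injectiveˡ {u = u} {w} {u′} {w′} eq
        with nonzeroEntry? u
      ... | yes (i , p∤uᵢ) =
        refl , parallel-determined {u = u} i p∤uᵢ u∥w u′∥w′ (Vec.∷-injectiveˡ (inj₁-injective eq))
      ... | no  _          = refl , inj₂-injective eq

    singular⇒parallel : ∀ v → InB' p v → Parallel (take 3 v) (drop 3 v)
    singular⇒parallel (a ∷ b ∷ c ∷ d ∷ e ∷ f ∷ []) (p∣R , p∣Ra , _ , p∣Rc , p∣Rd , _ , p∣Rf) =
      parallel₃ {u = a ∷ b ∷ c ∷ []} {d ∷ e ∷ f ∷ []} p∣ae-bd p∣af-cd p∣bf-ce
      where
      A = lift a ; B = lift b ; C = lift c ; D = lift d ; E = lift e ; F = lift f

      p∣ae-bd : + p ∣ A *ᶻ E -ᶻ B *ᶻ D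
      p∣ae-bd = ∣m*m⇒∣m _ (subst (+ p ∣_) (sym (square-ae-bd A B C D E F))
        (∣m∣n⇒∣m+n (∣n⇒∣m*n A (∣ᵤ⇒∣ p∣Rc)) (∣n⇒∣m*n D (∣ᵤ⇒∣ p∣Rf))))

      p∣bf-ce : + p ∣ B *ᶻ F -ᶻ C *ᶻ E
      p∣bf-ce = ∣m*m⇒∣m _ (subst (+ p ∣_) (sym (square-bf-ce A B C D E F))
        (∣m∣n⇒∣m+n (∣n⇒∣m*n C (∣ᵤ⇒∣ p∣Ra)) (∣n⇒∣m*n F (∣ᵤ⇒∣ p∣Rd))))

      p∣af-cd : + p ∣ A *ᶻ F -ᶻ C *ᶻ D
      p∣af-cd = ∣m*m⇒∣m _ (subst (+ p ∣_) (sym (square-af-cd A B C D E F))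
        (∣m∣n⇒∣m+n {m = R A B C D E F} (∣ᵤ⇒∣ p∣R) (∣n⇒∣m*n (A *ᶻ E -ᶻ B *ᶻ D) p∣bf-ce)))

    cardB′≤ : cardB' p ℕ.≤ p ^ 4 + p ^ 3
    cardB′≤ = begin
      cardB' p                 ≤⟨ unique-injection⇒length≤ code
                                    (Unique.filter⁺ (inB'? p) (allVecs-unique p 6))
                                    code-injective (λ _ → ∈-allVecs⊎ p _) ⟩
      length (allVecs⊎ p 4 3)  ≡⟨ length-allVecs⊎ p 4 3 ⟩
      p ^ 4 + p ^ 3            ∎
      where
      open ℕ.≤-Reasoning

      code : Vec (Fin p) 6 → Vec (Fin p) 4 ⊎ Vec (Fin p) 3
      code v = encode (take 3 v) (drop 3 v)

      B′ : List (Vec (Fin p) 6)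
      B′ = filter (inB'? p) (allVecs p 6)

      singular : ∀ {v} → v ∈ B′ → InB' p v
      singular = proj₂ ∘ ∈-filter⁻ (inB'? p) {xs = allVecs p 6}

      code-injective : ∀ {v v′} → v ∈ B′ → v′ ∈ B′ → code v ≡ code v′ → v ≡ v′
      code-injective {v} {v′} v∈ v′∈ eq
        with take≡ , drop≡ ← encode-injective (singular⇒parallel v (singular v∈))
                                           (singular⇒parallel v′ (singular v′∈)) eq
        = trans (sym (Vec.take++drop≡id 3 v))
                (trans (cong₂ Vec._++_ take≡ drop≡) (Vec.take++drop≡id 3 v′))

proposition5p3 : (p : ℕ) → Prime p → 3 < p → cardB' p < p ^ 4 + 3 * p ^ 3
proposition5p3 p p-prime 3<p = ℕ.≤-<-trans (cardB′≤ p-prime) (ℕ.+-monoʳ-< (p ^ 4) p³<3p³)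
  where
  p³>0 : 0 < p ^ 3
  p³>0 = ℕ.m^n>0 p {{ℕ.>-nonZero (ℕ.<-trans ℕ.z<s 3<p)}} 3

  p³<3p³ : p ^ 3 < 3 * p ^ 3
  p³<3p³ = ℕ.m<m+n (p ^ 3) (ℕ.<-≤-trans p³>0 (ℕ.m≤m+n (p ^ 3) _))
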